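{- Let $t=k_1\cdot x_1+\dots+k_r\cdot x_r$ be a homogeneous term with $\gcd(|k_1|,\dots,|k_r|)=1$, let $c\in\mathbb Z$ and $\bowtie\in\{=,\neq,<,\leq,>,\geq\}$, let $m$ be the largest small integer and $n$ the smallest large integer, and let $\mathcal A^{t\bowtie c}_{(m,n)}=(Q,\Sigma^r,\delta,q_I,F)$. Let $S=\{s\in Q\cap\mathbb Z: -\|t\|_+<s<\|t\|_-\}$. Then every state $q\in Q\cap\mathbb Z$ is reachable from every $p\in S$, i.e., there is $u\in(\Sigma^r)^*$ with $\widehat\delta(p,u)=q$.
   Context: Fix an integer base $\varrho\geq2$ and $\Sigma=\{0,\dots,\varrho-1\}$. A homogeneous term is $0$ or $k_1\cdot x_1+\dots+k_r\cdot x_r$ with distinct variables and nonzero integer $k_i$; $t[\bar a]=\sum k_ia_i$; $\|t\|_-=\sum_{k_j<0}|k_j|$, $\|t\|_+=\sum_{k_j>0}k_j$. An integer $q$ is small if $q<\min\{c,-\|t\|_+\}$ and large if $q>\max\{c,\|t\|_-\}$. A letter $\bar b=(b_1,\dots,b_r)\in\Sigma^r$ is identified with the tuple $(b_1,\dots,b_r)$, and $\sigma(\bar b)=(c_1,\dots,c_r)$ with $c_i=0$ if $b_i=0$, $c_i=-1$ otherwise. Let $\eta(q_I,\bar b)=t[\sigma(\bar b)]$ and $\eta(q,\bar b)=\varrho q+t[\bar b]$ for $q\in\mathbb Z$. The DWA $\mathcal A^{t\bowtie c}_{(m,n)}$ has states $Q=\{q_I\}\cup\{q\in\mathbb Z:m\leq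 q\leq n\}$ ($q_I$ a new initial state), transitions $\delta(q,\bar b)=m$ if $\eta(q,\bar b)\leq m$, $=n$ if $\eta(q,\bar b)\geq n$, and $=\eta(q,\bar b)$ otherwise, and accepting states $F=\{q\in Q\cap\mathbb Z:q\bowtie c\}$. $\widehat\delta$ is the extension of $\delta$ to words. -}

module Defs where

open import Data.Nat as ℕ using (ℕ)
open import Data.Nat.GCD using (gcd)
open import Data.Integer as ℤ using (ℤ; +_; _+_; _*_; -_; ∣_∣; _<_; _≤_; _>_; _≥_; _≤ᵇ_)
open import Data.Integer.Base using (-1ℤ; 0ℤ)
open import Data.Fin using (Fin; toℕ)
open import Data.Vec using (Vec; []; _∷_; foldr; zipWith; map)
open import Data.List using (List; []; _∷_)
open import Data.Bool using (Bool; true; false; if_then_else_)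
open import Relation.Binary.PropositionalEquality using (_≡_; _≢_)
open import Relation.Nullary using (¬_)

-- A homogeneous term k₁·x₁ + … + k_r·x_r is given by its coefficient vector
-- (all coefficients nonzero, see the statement).
Term : ℕ → Set
Term r = Vec ℤ r

gcdAbs : ∀ {r} → Term r → ℕ
gcdAbs = foldr _ (λ k g → gcd ∣ k ∣ g) 0

eval : ∀ {r} → Term r → Vec ℤ r → ℤ
eval t a = foldr _ _+_ 0ℤ (zipWith _*_ t a)

norm- : ∀ {r} → Term r → ℤ
norm- = foldr _ (λ k s → if k ≤ᵇ -1ℤ then (+ ∣ k ∣) + s else s) 0ℤ

norm+ : ∀ {r} → Term r → ℤ
norm+ = foldr _ (λ k s → if (+ 1) ≤ᵇ k then k + s else s) 0ℤ

data Rel : Set where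
  eq neq lt le gt ge : Rel

⟦_⟧ : Rel → ℤ → ℤ → Set
⟦ eq ⟧  a b = a ≡ b
⟦ neq ⟧ a b = a ≢ b
⟦ lt ⟧  a b = a < b
⟦ le ⟧  a b = a ≤ b
⟦ gt ⟧  a b = a > b
⟦ ge ⟧  a b = a ≥ b

Small : ∀ {r} → Term r → ℤ → ℤ → Set
Small t c q = q < c ℤ.⊓ (- norm+ t)

Large : ∀ {r} → Term r → ℤ → ℤ → Set
Large t c q = q > c ℤ.⊔ norm- t

Letter : ℕ → ℕ → Set
Letter ϱ r = Vec (Fin ϱ) r

letterℤ : ∀ {ϱ r} → Letter ϱ r → Vec ℤ r
letterℤ = map (λ b → + toℕ b)

σ : ∀ {ϱ r} → Letter ϱ r → Vec ℤ r
σ = map (λ b → σ₁ (toℕ b))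
  where
  σ₁ : ℕ → ℤ
  σ₁ ℕ.zero = 0ℤ
  σ₁ (ℕ.suc _) = -1ℤ

-- states: the fresh initial state q_I, or an integer state
-- (only integers in [m,n] are states of the automaton; the transition
--  function below never leaves [m,n] from such a state)
data State : Set where
  qI  : State
  int : ℤ → State

η : ∀ {ϱ r} → Term r → State → Letter ϱ r → ℤ
η t qI      b = eval t (σ b)
η {ϱ} t (int q) b = (+ ϱ) * q + eval t (letterℤ b)

clamp : ℤ → ℤ → ℤ → ℤ
clamp m n e = if e ≤ᵇ m then m else (if n ≤ᵇ e then n else e)

δ : (ϱ : ℕ) {r : ℕ} → Term r → (m n : ℤ) → State → Letter ϱ r → State
δ ϱ t m n q b = int (clamp m n (η t q b))

δ̂ : (ϱ : ℕ) {r : ℕ} → Term r → (m n : ℤ) → State → List (Letter ϱ r) → State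
δ̂ ϱ t m n q []       = q
δ̂ ϱ t m n q (b ∷ u)  = δ̂ ϱ t m n (δ ϱ t m n q b) u

Accepting : Rel → ℤ → (m n : ℤ) → State → Set
Accepting R c m n qI      = Data.Empty.⊥
  where import Data.Empty
Accepting R c m n (int q) = (m ≤ q) Data.Product.× (q ≤ n) Data.Product.× ⟦ R ⟧ q c
  where import Data.Product

{-# OPTIONS --safe #-}
-- Let N = ‖t‖₋ and P = ‖t‖₊. Reading the digit d of a coordinate with positive coefficient as d and
-- that of a coordinate with negative coefficient as ϱ−1−d, the unclamped transition becomes
-- x ↦ ϱ(x − N) + Σ|kᵢ|dᵢ + N, so the word spelling a vector v with all vᵢ < ϱᵏ in base ϱ moves x to
-- ϱᵏ(x − N) + Σ|kᵢ|vᵢ + N. For p ∈ S we have 1 ≤ N − p < ‖t‖, and since gcd |kᵢ| = 1 a Bézout vector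
-- yields, for k large, such a v with Σ|kᵢ|vᵢ = ϱᵏ(N − p) + q − N: this word takes p to q. Clamping never
-- fires on the way, because at or below −P a transition cannot increase the state and at or above N it
-- cannot decrease it, so a run ending strictly between m < −P and n > N stayed there. Finally m and n are
-- reached from m + 1 and n − 1 by the letters with all digits 0 and all digits ϱ−1 respectively.
module Submission where

open import Defs
open import Data.Nat using (ℕ)
open import Data.Integer using (ℤ; _<_; _≤_; -_; 0ℤ)
open import Data.Vec using (Vec)
open import Data.Vec.Relation.Unary.All using (All)
open import Data.List using (List)
open import Data.Product using (Σ; _×_)
open import Relation.Binary.PropositionalEquality using (_≡_; _≢_)
open import Relation.Nullary using (¬_)

open import Data.Nat as ℕ using (zero; suc; z≤n; s≤s; _^_)
import Data.Nat.Properties as ℕₚ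
open import Data.Bool using (true; false) renaming (T to True)
open import Data.Empty using (⊥-elim)
open import Data.Fin as Fin using (Fin; toℕ; opposite; fromℕ)
import Data.Fin.Properties as Finₚ
open import Data.List as List using ([]; _∷_; _∷ʳ_; foldl)
import Data.List.Properties as Listₚ
open import Data.Nat.DivMod using (_mod_; _/_; _%_; m≡m%n+[m/n]*n; m<n*o⇒m/o<n)
open import Data.Nat.GCD using (gcd; gcd-GCD; module Bézout)
open import Data.Integer as ℤ using (+_; -[1+_]; +[1+_]; +0; _+_; _-_; _*_; ∣_∣; 1ℤ; +≤+; +<+; -≤+; -≤-)
import Data.Integer.Properties as ℤₚ
open import Data.Integer.DivMod using (_/ℕ_; _%ℕ_; a≡a%ℕn+[a/ℕn]*n; n%ℕd<d)
open import Data.Integer.Tactic.RingSolver using (solve-∀)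
open import Data.Product using (_,_; proj₁; proj₂)
open import Data.Vec using ([]; _∷_; map; replicate; zipWith)
import Data.Vec.Properties as Vecₚ
open import Data.Vec.Relation.Unary.All as All using ([]; _∷_)
open import Data.Vec.Relation.Unary.All.Properties using (map⁺)
open import Relation.Binary.PropositionalEquality using (refl; sym; trans; cong; cong₂; subst; module ≡-Reasoning)
open import Relation.Nullary using (yes; no)

≤-by-certificate : ∀ {i j} k → j - i ≡ k → 0ℤ ≤ k → i ≤ j
≤-by-certificate k j-i≡k 0≤k = ℤₚ.0≤i-j⇒j≤i (subst (0ℤ ≤_) (sym j-i≡k) 0≤k)

infixl 6 _⊕_
_⊕_ : ∀ {i j} → 0ℤ ≤ i → 0ℤ ≤ j → 0ℤ ≤ i + j
_⊕_ = ℤₚ.+-mono-≤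

0≤i*j : ∀ {i j} → 0ℤ ≤ i → 0ℤ ≤ j → 0ℤ ≤ i * j
0≤i*j {+ m} {+ n} _ _ = subst (0ℤ ≤_) (ℤₚ.pos-* m n) (+≤+ z≤n)

∣i∣≤n⇒-n≤i≤n : ∀ {i n} → ∣ i ∣ ℕ.≤ n → (- + n ≤ i) × (i ≤ + n)
∣i∣≤n⇒-n≤i≤n {+ _}      ∣i∣≤n       = ℤₚ.neg-≤-pos , +≤+ ∣i∣≤n
∣i∣≤n⇒-n≤i≤n { -[1+ _ ]} (s≤s ∣i∣≤n) = -≤- ∣i∣≤n , -≤+

n<m^n : ∀ {m} → 1 ℕ.< m → ∀ n → n ℕ.< m ^ n
n<m^n 1<m zero    = s≤s z≤n
n<m^n {m} 1<m (suc n) = begin-strict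
  suc n             ≤⟨ n<m^n 1<m n ⟩
  m ^ n             <⟨ ℕₚ.m<m+n (m ^ n) (ℕₚ.≤-<-trans z≤n (n<m^n 1<m n)) ⟩
  m ^ n ℕ.+ m ^ n   ≡⟨ cong (m ^ n ℕ.+_) (sym (ℕₚ.+-identityʳ (m ^ n))) ⟩
  2 ℕ.* m ^ n       ≤⟨ ℕₚ.*-monoˡ-≤ (m ^ n) 1<m ⟩
  m ℕ.* m ^ n       ∎
  where open ℕₚ.≤-Reasoning

All-replicate : ∀ {A : Set} {P : A → Set} {x} n → P x → All P (replicate n x)
All-replicate zero    _  = []
All-replicate (suc n) px = px ∷ All-replicate n px

norm : ∀ {r} → Vec ℤ r → ℕ
norm []       = 0
norm (k ∷ ks) = ∣ k ∣ ℕ.+ norm ks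

∣∣≤norm : ∀ {r} (a : Vec ℤ r) → All (λ z → ∣ z ∣ ℕ.≤ norm a) a
∣∣≤norm []      = []
∣∣≤norm (z ∷ a) = ℕₚ.m≤m+n ∣ z ∣ (norm a) ∷ All.map (λ h → ℕₚ.≤-trans h (ℕₚ.m≤n+m (norm a) ∣ z ∣)) (∣∣≤norm a)

norm≡norm++norm- : ∀ {r} (t : Term r) → + norm t ≡ norm+ t + norm- t
norm≡norm++norm- []              = refl
norm≡norm++norm- (+0 ∷ t)        = norm≡norm++norm- t
norm≡norm++norm- (+[1+ n ] ∷ t)  = begin
  + (suc n ℕ.+ norm t)            ≡⟨ ℤₚ.pos-+ (suc n) (norm t) ⟩
  +[1+ n ] + + norm t             ≡⟨ cong (_+_ +[1+ n ]) (norm≡norm++norm- t) ⟩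
  +[1+ n ] + (norm+ t + norm- t)  ≡⟨ sym (ℤₚ.+-assoc +[1+ n ] (norm+ t) (norm- t)) ⟩
  +[1+ n ] + norm+ t + norm- t    ∎
  where open ≡-Reasoning
norm≡norm++norm- (-[1+ n ] ∷ t) = begin
  + (suc n ℕ.+ norm t)            ≡⟨ ℤₚ.pos-+ (suc n) (norm t) ⟩
  +[1+ n ] + + norm t             ≡⟨ cong (_+_ +[1+ n ]) (norm≡norm++norm- t) ⟩
  +[1+ n ] + (norm+ t + norm- t)  ≡⟨ x+[y+z]≡y+[x+z] +[1+ n ] (norm+ t) (norm- t) ⟩
  norm+ t + (+[1+ n ] + norm- t)  ∎
  where
  open ≡-Reasoning
  x+[y+z]≡y+[x+z] : ∀ x y z → x + (y + z) ≡ y + (x + z)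
  x+[y+z]≡y+[x+z] = solve-∀

weight : ∀ {r} → Term r → Vec ℤ r → ℤ
weight []      []       = 0ℤ
weight (k ∷ t) (a ∷ as) = + ∣ k ∣ * a + weight t as

weight-affine : ∀ {r} (t : Term r) x c a → weight t (map (λ z → x + c * z) a) ≡ x * + norm t + c * weight t a
weight-affine []      x c []       = sym (cong₂ _+_ (ℤₚ.*-zeroʳ x) (ℤₚ.*-zeroʳ c))
weight-affine (k ∷ t) x c (a ∷ as) = begin
  + ∣ k ∣ * (x + c * a) + weight t (map (λ z → x + c * z) as)  ≡⟨ cong (_+_ (+ ∣ k ∣ * (x + c * a))) (weight-affine t x c as) ⟩
  + ∣ k ∣ * (x + c * a) + (x * + norm t + c * weight t as)      ≡⟨ distribute (+ ∣ k ∣) x c a (+ norm t) (weight t as) ⟩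
  x * (+ ∣ k ∣ + + norm t) + c * (+ ∣ k ∣ * a + weight t as)   ≡⟨ cong (λ n → x * n + c * (+ ∣ k ∣ * a + weight t as)) (sym (ℤₚ.pos-+ ∣ k ∣ (norm t))) ⟩
  x * + norm (k ∷ t) + c * weight (k ∷ t) (a ∷ as)              ∎
  where
  open ≡-Reasoning
  distribute : ∀ k x c a n w → k * (x + c * a) + (x * n + c * w) ≡ x * (k + n) + c * (k * a + w)
  distribute = solve-∀

weight-scale : ∀ {r} (t : Term r) c a → weight t (map (c *_) a) ≡ c * weight t a
weight-scale t c a = begin
  weight t (map (c *_) a)               ≡⟨ cong (weight t) (Vecₚ.map-cong (λ z → sym (ℤₚ.+-identityˡ (c * z))) a) ⟩
  weight t (map (λ z → 0ℤ + c * z) a)   ≡⟨ weight-affine t 0ℤ c a ⟩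
  0ℤ + c * weight t a                   ≡⟨ ℤₚ.+-identityˡ (c * weight t a) ⟩
  c * weight t a                        ∎
  where open ≡-Reasoning

weight-≤ : ∀ {r} (t : Term r) {x a} → All (_≤ x) a → weight t a ≤ x * + norm t
weight-≤ []      {x} []          = ℤₚ.≤-reflexive (sym (ℤₚ.*-zeroʳ x))
weight-≤ (k ∷ t) {x} (a≤x ∷ as≤x) = ℤₚ.≤-trans
  (ℤₚ.+-mono-≤ (ℤₚ.*-monoˡ-≤-nonNeg (+ ∣ k ∣) a≤x) (weight-≤ t as≤x))
  (ℤₚ.≤-reflexive (trans (split (+ ∣ k ∣) x (+ norm t)) (cong (x *_) (sym (ℤₚ.pos-+ ∣ k ∣ (norm t))))))
  where
  split : ∀ k x n → k * x + x * n ≡ x * (k + n)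
  split = solve-∀

weight-≥ : ∀ {r} (t : Term r) {x a} → All (x ≤_) a → x * + norm t ≤ weight t a
weight-≥ []      {x} []          = ℤₚ.≤-reflexive (ℤₚ.*-zeroʳ x)
weight-≥ (k ∷ t) {x} (x≤a ∷ x≤as) = ℤₚ.≤-trans
  (ℤₚ.≤-reflexive (trans (cong (x *_) (ℤₚ.pos-+ ∣ k ∣ (norm t))) (split (+ ∣ k ∣) x (+ norm t))))
  (ℤₚ.+-mono-≤ (ℤₚ.*-monoˡ-≤-nonNeg (+ ∣ k ∣) x≤a) (weight-≥ t x≤as))
  where
  split : ∀ k x n → x * (k + n) ≡ k * x + x * n
  split = solve-∀

pos-affine : ∀ g a b c d → g ℕ.+ a ℕ.* b ≡ c ℕ.* d → + g + + a * + b ≡ + c * + d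
pos-affine g a b c d e = begin
  + g + + a * + b     ≡⟨ cong (_+_ (+ g)) (sym (ℤₚ.pos-* a b)) ⟩
  + g + + (a ℕ.* b)   ≡⟨ sym (ℤₚ.pos-+ g (a ℕ.* b)) ⟩
  + (g ℕ.+ a ℕ.* b)   ≡⟨ cong +_ e ⟩
  + (c ℕ.* d)         ≡⟨ ℤₚ.pos-* c d ⟩
  + c * + d           ∎
  where open ≡-Reasoning

Bézout-ℤ : ∀ x y → Σ ℤ λ u → Σ ℤ λ w → u * + x + w * + y ≡ + gcd x y
Bézout-ℤ x y with Bézout.identity (gcd-GCD x y)
... | Bézout.+- u w g+wy≡ux = + u , - + w , (begin
  + u * + x + (- + w) * + y                 ≡⟨ cong (λ ux → ux + (- + w) * + y) (sym (pos-affine (gcd x y) w y u x g+wy≡ux)) ⟩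
  + gcd x y + + w * + y + (- + w) * + y     ≡⟨ cancel (+ gcd x y) (+ w) (+ y) ⟩
  + gcd x y                                 ∎)
  where
  open ≡-Reasoning
  cancel : ∀ g w y → g + w * y + (- w) * y ≡ g
  cancel = solve-∀
... | Bézout.-+ u w g+ux≡wy = - + u , + w , (begin
  (- + u) * + x + + w * + y                 ≡⟨ cong (λ wy → (- + u) * + x + wy) (sym (pos-affine (gcd x y) u x w y g+ux≡wy)) ⟩
  (- + u) * + x + (+ gcd x y + + u * + x)   ≡⟨ cancel (+ gcd x y) (+ u) (+ x) ⟩
  + gcd x y                                 ∎)
  where
  open ≡-Reasoning
  cancel : ∀ g u x → (- u) * x + (g + u * x) ≡ g
  cancel = solve-∀

weight-Bézout : ∀ {r} (t : Term r) → Σ (Vec ℤ r) λ a → weight t a ≡ + gcdAbs t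
weight-Bézout []      = [] , refl
weight-Bézout (k ∷ t) with weight-Bézout t | Bézout-ℤ ∣ k ∣ (gcdAbs t)
... | a , wa≡g | u , w , u∣k∣+wg≡gcd = u ∷ map (w *_) a , (begin
  + ∣ k ∣ * u + weight t (map (w *_) a)  ≡⟨ cong (_+_ (+ ∣ k ∣ * u)) (trans (weight-scale t w a) (cong (w *_) wa≡g)) ⟩
  + ∣ k ∣ * u + w * + gcdAbs t           ≡⟨ cong (_+ w * + gcdAbs t) (ℤₚ.*-comm (+ ∣ k ∣) u) ⟩
  u * + ∣ k ∣ + w * + gcdAbs t           ≡⟨ u∣k∣+wg≡gcd ⟩
  + gcdAbs (k ∷ t)                       ∎)
  where open ≡-Reasoning

i≤+∣i∣ : ∀ i → i ≤ + ∣ i ∣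
i≤+∣i∣ (+ _)      = ℤₚ.≤-refl
i≤+∣i∣ -[1+ _ ] = -≤+

nonneg-lift : ∀ {r M} (w : Vec ℤ r) → All (λ z → 0ℤ ≤ z × z < + M) w → Σ (Vec ℕ r) λ v → All (ℕ._< M) v × map +_ v ≡ w
nonneg-lift []             []                      = [] , [] , refl
nonneg-lift (+ n ∷ w)      ((_ , +<+ n<M) ∷ w-bounded) with nonneg-lift w w-bounded
... | v , v<M , v≡w = n ∷ v , n<M ∷ v<M , cong (+ n ∷_) v≡w
nonneg-lift (-[1+ _ ] ∷ _) ((() , _) ∷ _)

-- Write T = M h + d as ρ + x ‖t‖ with 0 ≤ ρ < ‖t‖ and put vᵢ = x + ρ aᵢ; the bound on M keeps every vᵢ in [0, M).
module BoxRepresentation {r} (t : Term r) (a : Vec ℤ r) (wa≡1 : weight t a ≡ 1ℤ) (M : ℕ) {h d : ℤ}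
                         (1≤h : 1ℤ ≤ h) (h<K : h < + norm t)
                         (C≤M : + norm t * + norm t * + norm a + + norm t + + ∣ d ∣ ≤ + M) where

  K A D T : ℤ
  K = + norm t
  A = + norm a
  D = + ∣ d ∣
  T = + M * h + d

  0<K : 0ℤ < K
  0<K = ℤₚ.<-trans (ℤₚ.<-≤-trans (+<+ (s≤s z≤n)) 1≤h) h<K

  instance
    K-positive : ℤ.Positive K
    K-positive = ℤ.positive 0<K
    norm-nonZero : ℕ.NonZero (norm t)
    norm-nonZero = ℕ.>-nonZero (ℤₚ.drop‿+<+ 0<K)

  ρ : ℕ
  ρ = T %ℕ norm t

  x : ℤ
  x = T /ℕ norm t

  Kx≡T-ρ : K * x ≡ T - + ρ
  Kx≡T-ρ = begin
    K * x               ≡⟨ ℤₚ.*-comm K x ⟩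
    x * K               ≡⟨ add-sub (+ ρ) (x * K) ⟩
    + ρ + x * K - + ρ   ≡⟨ cong (_- + ρ) (sym (a≡a%ℕn+[a/ℕn]*n T (norm t))) ⟩
    T - + ρ             ∎
    where
    open ≡-Reasoning
    add-sub : ∀ r y → y ≡ r + y - r
    add-sub = solve-∀

  -D≤d≤D : (- D ≤ d) × (d ≤ D)
  -D≤d≤D = ∣i∣≤n⇒-n≤i≤n ℕₚ.≤-refl

  0≤M-C : 0ℤ ≤ + M - (K * K * A + K + D)
  0≤M-C = ℤₚ.i≤j⇒0≤j-i C≤M

  KA≤x : K * A ≤ x
  KA≤x = ℤₚ.*-cancelˡ-≤-pos (K * A) x K (subst (K * (K * A) ≤_) (sym Kx≡T-ρ)
    (≤-by-certificate _ (certificate (+ M) h d (+ ρ) K A D)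
      (0≤i*j (ℤₚ.nonNegative⁻¹ (+ M)) (ℤₚ.i≤j⇒0≤j-i 1≤h) ⊕ 0≤M-C
        ⊕ ℤₚ.i≤j⇒0≤j-i (ℤₚ.i<j⇒suc[i]≤j (+<+ (n%ℕd<d T (norm t)))) ⊕ ℤₚ.i≤j⇒0≤j-i (proj₁ -D≤d≤D) ⊕ +≤+ z≤n)))
    where
    certificate : ∀ M h d ρ K A D →
      (M * h + d - ρ) - K * (K * A) ≡ M * (h - 1ℤ) + (M - (K * K * A + K + D)) + (K - (1ℤ + ρ)) + (d - (- D)) + 1ℤ
    certificate = solve-∀

  x+KA<M : x + K * A < + M
  x+KA<M = ℤₚ.suc[i]≤j⇒i<j (ℤₚ.*-cancelˡ-≤-pos (1ℤ + (x + K * A)) (+ M) K (subst (_≤ K * + M) (sym K[1+x+KA]≡)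
    (≤-by-certificate _ (certificate (+ M) h d (+ ρ) K A D)
      (0≤i*j (ℤₚ.nonNegative⁻¹ (+ M)) (ℤₚ.i≤j⇒0≤j-i (ℤₚ.i<j⇒suc[i]≤j h<K)) ⊕ 0≤M-C
        ⊕ ℤₚ.i≤j⇒0≤j-i (proj₂ -D≤d≤D) ⊕ ℤₚ.nonNegative⁻¹ (+ ρ)))))
    where
    expand : ∀ K x A → K * (1ℤ + (x + K * A)) ≡ K + K * x + K * (K * A)
    expand = solve-∀
    K[1+x+KA]≡ : K * (1ℤ + (x + K * A)) ≡ K + (T - + ρ) + K * (K * A)
    K[1+x+KA]≡ = trans (expand K x A) (cong (λ Kx → K + Kx + K * (K * A)) Kx≡T-ρ)
    certificate : ∀ M h d ρ K A D →
      K * M - (K + (M * h + d - ρ) + K * (K * A)) ≡ M * (K - (1ℤ + h)) + (M - (K * K * A + K + D)) + (D - d) + ρ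
    certificate = solve-∀

  f : ℤ → ℤ
  f z = x + + ρ * z

  f-bounded : ∀ {z} → ∣ z ∣ ℕ.≤ norm a → 0ℤ ≤ f z × f z < + M
  f-bounded {z} ∣z∣≤A =
      ℤₚ.≤-trans (ℤₚ.i≤j⇒0≤j-i KA≤x) (ℤₚ.+-monoʳ-≤ x (subst (λ B → - B ≤ + ρ * z) KA≡ (proj₁ ρz-bounds)))
    , ℤₚ.≤-<-trans (ℤₚ.+-monoʳ-≤ x (subst (+ ρ * z ≤_) KA≡ (proj₂ ρz-bounds))) x+KA<M
    where
    ρz-bounds : (- + (norm t ℕ.* norm a) ≤ + ρ * z) × (+ ρ * z ≤ + (norm t ℕ.* norm a))
    ρz-bounds = ∣i∣≤n⇒-n≤i≤n (subst (ℕ._≤ norm t ℕ.* norm a) (sym (ℤₚ.abs-* (+ ρ) z))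
                                   (ℕₚ.*-mono-≤ (ℕₚ.<⇒≤ (n%ℕd<d T (norm t))) ∣z∣≤A))
    KA≡ : + (norm t ℕ.* norm a) ≡ K * A
    KA≡ = ℤₚ.pos-* (norm t) (norm a)

  weight-fa : weight t (map f a) ≡ T
  weight-fa = begin
    weight t (map f a)           ≡⟨ weight-affine t x (+ ρ) a ⟩
    x * K + + ρ * weight t a     ≡⟨ cong (λ w → x * K + + ρ * w) wa≡1 ⟩
    x * K + + ρ * 1ℤ             ≡⟨ regroup x K (+ ρ) ⟩
    + ρ + x * K                  ≡⟨ sym (a≡a%ℕn+[a/ℕn]*n T (norm t)) ⟩
    T                            ∎
    where
    open ≡-Reasoning
    regroup : ∀ x K ρ → x * K + ρ * 1ℤ ≡ ρ + x * K
    regroup = solve-∀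

  box-representation : Σ (Vec ℕ r) λ v → All (ℕ._< M) v × weight t (map +_ v) ≡ + M * h + d
  box-representation =
    let v , v<M , v≡fa = nonneg-lift (map f a) (map⁺ (All.map f-bounded (∣∣≤norm a)))
    in  v , v<M , trans (cong (weight t) v≡fa) weight-fa

open BoxRepresentation using (box-representation)

≰⇒≤ᵇ≡false : ∀ {i j} → ¬ i ≤ j → (i ℤ.≤ᵇ j) ≡ false
≰⇒≤ᵇ≡false {i} {j} i≰j with i ℤ.≤ᵇ j in i≤ᵇj
... | true  = ⊥-elim (i≰j (ℤₚ.≤ᵇ⇒≤ (subst True (sym i≤ᵇj) _)))
... | false = refl

≤⇒≤ᵇ≡true : ∀ {i j} → i ≤ j → (i ℤ.≤ᵇ j) ≡ true
≤⇒≤ᵇ≡true {i} {j} i≤j with i ℤ.≤ᵇ j | ℤₚ.≤⇒≤ᵇ i≤j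
... | true | _ = refl

clamp-inside : ∀ {m n e} → m < e → e < n → clamp m n e ≡ e
clamp-inside m<e e<n rewrite ≰⇒≤ᵇ≡false (ℤₚ.<⇒≱ m<e) | ≰⇒≤ᵇ≡false (ℤₚ.<⇒≱ e<n) = refl

clamp-below : ∀ {m n e} → e ≤ m → clamp m n e ≡ m
clamp-below e≤m rewrite ≤⇒≤ᵇ≡true e≤m = refl

clamp-above : ∀ {m n e} → m < e → n ≤ e → clamp m n e ≡ n
clamp-above m<e n≤e rewrite ≰⇒≤ᵇ≡false (ℤₚ.<⇒≱ m<e) | ≤⇒≤ᵇ≡true n≤e = refl

δ̂-∷ʳ : ∀ ϱ {r} (t : Term r) m n q u b → δ̂ ϱ t m n q (u ∷ʳ b) ≡ δ ϱ t m n (δ̂ ϱ t m n q u) b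
δ̂-∷ʳ ϱ t m n q []      b = refl
δ̂-∷ʳ ϱ t m n q (c ∷ u) b = δ̂-∷ʳ ϱ t m n (δ ϱ t m n q c) u b

module Automaton (ϱ₁ : ℕ) where

  ϱ : ℕ
  ϱ = suc ϱ₁

  flipDigit : ℤ → Fin ϱ → Fin ϱ
  flipDigit (+ _)      d = d
  flipDigit -[1+ _ ] d = opposite d

  toLetter : ∀ {s} → Term s → Vec (Fin ϱ) s → Letter ϱ s
  toLetter = zipWith flipDigit

  eval-toLetter : ∀ {s} (u : Term s) ds → eval u (letterℤ (toLetter u ds)) + + ϱ₁ * norm- u ≡ weight u (letterℤ ds)
  eval-toLetter []             []       = trans (ℤₚ.+-identityˡ _) (ℤₚ.*-zeroʳ (+ ϱ₁))
  eval-toLetter (+ n ∷ u)      (d ∷ ds) = begin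
    + n * + toℕ d + eval u (letterℤ (toLetter u ds)) + + ϱ₁ * norm- u    ≡⟨ ℤₚ.+-assoc (+ n * + toℕ d) _ _ ⟩
    + n * + toℕ d + (eval u (letterℤ (toLetter u ds)) + + ϱ₁ * norm- u)  ≡⟨ cong (_+_ (+ n * + toℕ d)) (eval-toLetter u ds) ⟩
    + n * + toℕ d + weight u (letterℤ ds)                                ∎
    where open ≡-Reasoning
  eval-toLetter (-[1+ n ] ∷ u) (d ∷ ds) = begin
    -[1+ n ] * + toℕ (opposite d) + E + + ϱ₁ * (+[1+ n ] + norm- u)      ≡⟨ cong (λ o → -[1+ n ] * o + E + + ϱ₁ * (+[1+ n ] + norm- u)) +opposite ⟩
    - +[1+ n ] * (+ ϱ₁ - + toℕ d) + E + + ϱ₁ * (+[1+ n ] + norm- u)      ≡⟨ regroup +[1+ n ] (+ toℕ d) (+ ϱ₁) E (norm- u) ⟩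
    +[1+ n ] * + toℕ d + (E + + ϱ₁ * norm- u)                            ≡⟨ cong (_+_ (+[1+ n ] * + toℕ d)) (eval-toLetter u ds) ⟩
    +[1+ n ] * + toℕ d + weight u (letterℤ ds)                           ∎
    where
    open ≡-Reasoning
    E : ℤ
    E = eval u (letterℤ (toLetter u ds))
    +opposite : + toℕ (opposite d) ≡ + ϱ₁ - + toℕ d
    +opposite = begin
      + toℕ (opposite d)  ≡⟨ cong +_ (Finₚ.opposite-prop d) ⟩
      + (ϱ₁ ℕ.∸ toℕ d)    ≡⟨ sym (ℤₚ.⊖-≥ (Finₚ.toℕ≤pred[n] d)) ⟩
      ϱ₁ ℤ.⊖ toℕ d        ≡⟨ sym (ℤₚ.m-n≡m⊖n ϱ₁ (toℕ d)) ⟩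
      + ϱ₁ - + toℕ d      ∎
    regroup : ∀ S D R E N → - S * (R - D) + E + R * (S + N) ≡ S * D + (E + R * N)
    regroup = solve-∀

  digit-split : ∀ z → + z ≡ + toℕ (z mod ϱ) + + ϱ * + (z / ϱ)
  digit-split z = begin
    + z                             ≡⟨ cong +_ (m≡m%n+[m/n]*n z ϱ) ⟩
    + (z % ϱ ℕ.+ z / ϱ ℕ.* ϱ)       ≡⟨ ℤₚ.pos-+ (z % ϱ) (z / ϱ ℕ.* ϱ) ⟩
    + (z % ϱ) + + (z / ϱ ℕ.* ϱ)     ≡⟨ cong₂ _+_ (cong +_ (sym (Finₚ.toℕ-fromℕ< _))) (trans (cong +_ (ℕₚ.*-comm (z / ϱ) ϱ)) (ℤₚ.pos-* ϱ (z / ϱ))) ⟩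
    + toℕ (z mod ϱ) + + ϱ * + (z / ϱ) ∎
    where open ≡-Reasoning

  weight-digits : ∀ {s} (u : Term s) (v : Vec ℕ s) →
    weight u (map +_ v) ≡ weight u (letterℤ (map (_mod ϱ) v)) + + ϱ * weight u (map +_ (map (_/ ϱ) v))
  weight-digits []      []      = sym (trans (ℤₚ.+-identityˡ _) (ℤₚ.*-zeroʳ (+ ϱ)))
  weight-digits (k ∷ u) (z ∷ v) = begin
    + ∣ k ∣ * + z + weight u (map +_ v)
      ≡⟨ cong₂ (λ z′ w → + ∣ k ∣ * z′ + w) (digit-split z) (weight-digits u v) ⟩
    + ∣ k ∣ * (+ toℕ (z mod ϱ) + + ϱ * + (z / ϱ)) + (weight u (letterℤ (map (_mod ϱ) v)) + + ϱ * weight u (map +_ (map (_/ ϱ) v)))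
      ≡⟨ regroup (+ ∣ k ∣) (+ toℕ (z mod ϱ)) (+ (z / ϱ)) (+ ϱ) _ _ ⟩
    + ∣ k ∣ * + toℕ (z mod ϱ) + weight u (letterℤ (map (_mod ϱ) v)) + + ϱ * (+ ∣ k ∣ * + (z / ϱ) + weight u (map +_ (map (_/ ϱ) v)))
      ∎
    where
    open ≡-Reasoning
    regroup : ∀ k a b ϱ w w′ → k * (a + ϱ * b) + (w + ϱ * w′) ≡ k * a + w + ϱ * (k * b + w′)
    regroup = solve-∀

  weight-<1 : ∀ {s} (u : Term s) {v : Vec ℕ s} → All (ℕ._< 1) v → weight u (map +_ v) ≡ 0ℤ
  weight-<1 []      []              = refl
  weight-<1 (k ∷ u) (s≤s z≤n ∷ v<1) = cong₂ _+_ (ℤₚ.*-zeroʳ (+ ∣ k ∣)) (weight-<1 u v<1)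

  digitsWord : ∀ {s} → ℕ → Vec ℕ s → List (Vec (Fin ϱ) s)
  digitsWord zero    v = []
  digitsWord (suc k) v = digitsWord k (map (_/ ϱ) v) ∷ʳ map (_mod ϱ) v

  module _ {r} (t : Term r) where

    P N : ℤ
    P = norm+ t
    N = norm- t

    digitWeight : Vec (Fin ϱ) r → ℤ
    digitWeight d = weight t (letterℤ d)

    step : ℤ → Vec (Fin ϱ) r → ℤ
    step x d = η t (int x) (toLetter t d)

    run : ℤ → List (Vec (Fin ϱ) r) → ℤ
    run = foldl step

    step-shift : ∀ x d → step x d ≡ + ϱ * (x - N) + digitWeight d + N
    step-shift x d = begin
      + ϱ * x + eval t (letterℤ (toLetter t d))                         ≡⟨ regroup (+ ϱ₁) x N _ ⟩
      + ϱ * (x - N) + (eval t (letterℤ (toLetter t d)) + + ϱ₁ * N) + N  ≡⟨ cong (λ w → + ϱ * (x - N) + w + N) (eval-toLetter t d) ⟩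
      + ϱ * (x - N) + digitWeight d + N                                 ∎
      where
      open ≡-Reasoning
      regroup : ∀ g x N e → (1ℤ + g) * x + e ≡ (1ℤ + g) * (x - N) + (e + g * N) + N
      regroup = solve-∀

    run-digitsWord : ∀ k v → All (ℕ._< ϱ ^ k) v → ∀ x → run x (digitsWord k v) ≡ + (ϱ ^ k) * (x - N) + weight t (map +_ v) + N
    run-digitsWord zero    v v<1 x = begin
      x                                       ≡⟨ unshift x N ⟩
      1ℤ * (x - N) + 0ℤ + N                   ≡⟨ cong (λ w → 1ℤ * (x - N) + w + N) (sym (weight-<1 t v<1)) ⟩
      1ℤ * (x - N) + weight t (map +_ v) + N  ∎
      where
      open ≡-Reasoning
      unshift : ∀ x N → x ≡ 1ℤ * (x - N) + 0ℤ + N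
      unshift = solve-∀
    run-digitsWord (suc k) v v<ϱ^[1+k] x = begin
      run x (digitsWord k v′ ∷ʳ d)
        ≡⟨ Listₚ.foldl-∷ʳ step x d (digitsWord k v′) ⟩
      step (run x (digitsWord k v′)) d
        ≡⟨ step-shift (run x (digitsWord k v′)) d ⟩
      + ϱ * (run x (digitsWord k v′) - N) + digitWeight d + N
        ≡⟨ cong (λ y → + ϱ * (y - N) + digitWeight d + N) (run-digitsWord k v′ v′<ϱ^k x) ⟩
      + ϱ * (+ (ϱ ^ k) * (x - N) + weight t (map +_ v′) + N - N) + digitWeight d + N
        ≡⟨ regroup (+ ϱ) (+ (ϱ ^ k)) (x - N) _ N _ ⟩
      + ϱ * + (ϱ ^ k) * (x - N) + (digitWeight d + + ϱ * weight t (map +_ v′)) + N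
        ≡⟨ cong₂ (λ M w → M * (x - N) + w + N) (sym (ℤₚ.pos-* ϱ (ϱ ^ k))) (sym (weight-digits t v)) ⟩
      + (ϱ ^ suc k) * (x - N) + weight t (map +_ v) + N
        ∎
      where
      open ≡-Reasoning
      v′ = map (_/ ϱ) v
      d  = map (_mod ϱ) v
      v′<ϱ^k : All (ℕ._< ϱ ^ k) v′
      v′<ϱ^k = map⁺ (All.map (λ {z} z<ϱ^[1+k] → m<n*o⇒m/o<n (subst (z ℕ.<_) (ℕₚ.*-comm ϱ (ϱ ^ k)) z<ϱ^[1+k])) v<ϱ^[1+k])
      regroup : ∀ ϱ M y w N w′ → ϱ * (M * y + w + N - N) + w′ + N ≡ ϱ * M * y + (w′ + ϱ * w) + N
      regroup = solve-∀

    step-upper : ∀ x d {w} → digitWeight d ≤ w → step x d ≤ x + + ϱ₁ * (x - N) + w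
    step-upper x d {w} W≤w = begin
      step x d                           ≡⟨ step-shift x d ⟩
      + ϱ * (x - N) + digitWeight d + N  ≤⟨ ℤₚ.+-monoˡ-≤ N (ℤₚ.+-monoʳ-≤ (+ ϱ * (x - N)) W≤w) ⟩
      + ϱ * (x - N) + w + N              ≡⟨ regroup (+ ϱ₁) x N w ⟩
      x + + ϱ₁ * (x - N) + w             ∎
      where
      open ℤₚ.≤-Reasoning
      regroup : ∀ g x N w → (1ℤ + g) * (x - N) + w + N ≡ x + g * (x - N) + w
      regroup = solve-∀

    step-lower : ∀ x d {w} → w ≤ digitWeight d → x + + ϱ₁ * (x - N) + w ≤ step x d
    step-lower x d {w} w≤W = begin
      x + + ϱ₁ * (x - N) + w             ≡⟨ regroup (+ ϱ₁) x N w ⟩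
      + ϱ * (x - N) + w + N              ≤⟨ ℤₚ.+-monoˡ-≤ N (ℤₚ.+-monoʳ-≤ (+ ϱ * (x - N)) w≤W) ⟩
      + ϱ * (x - N) + digitWeight d + N  ≡⟨ step-shift x d ⟨
      step x d                           ∎
      where
      open ℤₚ.≤-Reasoning
      regroup : ∀ g x N w → x + g * (x - N) + w ≡ (1ℤ + g) * (x - N) + w + N
      regroup = solve-∀

    digitWeight-≤ : ∀ d → digitWeight d ≤ + ϱ₁ * (P + N)
    digitWeight-≤ d = subst (λ K → digitWeight d ≤ + ϱ₁ * K) (norm≡norm++norm- t)
      (weight-≤ t (map⁺ (All.universal (λ b → +≤+ (Finₚ.toℕ≤pred[n] b)) d)))

    digitWeight-≥ : ∀ d → 0ℤ ≤ digitWeight d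
    digitWeight-≥ d = weight-≥ t (map⁺ (All.universal (λ _ → +≤+ z≤n) d))

    zeros maxs : Vec (Fin ϱ) r
    zeros = replicate r Fin.zero
    maxs  = replicate r (fromℕ ϱ₁)

    step-≤-self : ∀ x d → x ≤ - P → step x d ≤ x
    step-≤-self x d x≤-P = begin
      step x d                             ≤⟨ step-upper x d (digitWeight-≤ d) ⟩
      x + + ϱ₁ * (x - N) + + ϱ₁ * (P + N)  ≡⟨ regroup x (+ ϱ₁) P N ⟩
      x + + ϱ₁ * (x + P)                   ≤⟨ ℤₚ.+-monoʳ-≤ x (ℤₚ.*-monoˡ-≤-nonNeg (+ ϱ₁) x+P≤0) ⟩
      x + + ϱ₁ * 0ℤ                        ≡⟨ cong (_+_ x) (ℤₚ.*-zeroʳ (+ ϱ₁)) ⟩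
      x + 0ℤ                               ≡⟨ ℤₚ.+-identityʳ x ⟩
      x                                    ∎
      where
      open ℤₚ.≤-Reasoning
      x+P≤0 : x + P ≤ 0ℤ
      x+P≤0 = subst (x + P ≤_) (ℤₚ.+-inverseˡ P) (ℤₚ.+-monoˡ-≤ P x≤-P)
      regroup : ∀ x g P N → x + g * (x - N) + g * (P + N) ≡ x + g * (x + P)
      regroup = solve-∀

    step-≥-self : ∀ x d → N ≤ x → x ≤ step x d
    step-≥-self x d N≤x = begin
      x                       ≡⟨ ℤₚ.+-identityʳ x ⟨
      x + 0ℤ                  ≤⟨ ℤₚ.+-monoʳ-≤ x (0≤i*j (ℤₚ.nonNegative⁻¹ (+ ϱ₁)) (ℤₚ.i≤j⇒0≤j-i N≤x)) ⟩
      x + + ϱ₁ * (x - N)      ≡⟨ ℤₚ.+-identityʳ _ ⟨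
      x + + ϱ₁ * (x - N) + 0ℤ ≤⟨ step-lower x d (digitWeight-≥ d) ⟩
      step x d                ∎
      where open ℤₚ.≤-Reasoning

    module Clamped {m n : ℤ} (m<-P : m < - P) (N<n : N < n) where

      Inside : ℤ → Set
      Inside x = m < x × x < n

      step-reflects-Inside : ∀ x d → Inside (step x d) → Inside x
      step-reflects-Inside x d (m<step , step<n) =
          ℤₚ.≰⇒> (λ x≤m → ℤₚ.<⇒≱ m<step (ℤₚ.≤-trans (step-≤-self x d (ℤₚ.<⇒≤ (ℤₚ.≤-<-trans x≤m m<-P))) x≤m))
        , ℤₚ.≰⇒> (λ n≤x → ℤₚ.<⇒≱ step<n (ℤₚ.≤-trans n≤x (step-≥-self x d (ℤₚ.<⇒≤ (ℤₚ.<-≤-trans N<n n≤x)))))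

      run-reflects-Inside : ∀ x ds → Inside (run x ds) → Inside x
      run-reflects-Inside x []       inside = inside
      run-reflects-Inside x (d ∷ ds) inside = step-reflects-Inside x d (run-reflects-Inside (step x d) ds inside)

      δ̂-run : ∀ x ds → Inside (run x ds) → δ̂ ϱ t m n (int x) (List.map (toLetter t) ds) ≡ int (run x ds)
      δ̂-run x []       _      = refl
      δ̂-run x (d ∷ ds) inside = trans
        (cong (λ e → δ̂ ϱ t m n (int e) (List.map (toLetter t) ds)) (clamp-inside m<step step<n))
        (δ̂-run (step x d) ds inside)
        where
        m<step = proj₁ (run-reflects-Inside (step x d) ds inside)
        step<n = proj₂ (run-reflects-Inside (step x d) ds inside)

    module _ .{{_ : ℕ.NonZero ϱ₁}} where

      instance
        ϱ₁-positive : ℤ.Positive (+ ϱ₁)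
        ϱ₁-positive = ℤ.positive (+<+ (ℕ.>-nonZero⁻¹ ϱ₁))

      step-zeros-< : ∀ x → x < N → step x zeros < x
      step-zeros-< x x<N = begin-strict
        step x zeros             ≤⟨ step-upper x zeros (weight-≤ t {0ℤ} (map⁺ (All-replicate r (+≤+ z≤n)))) ⟩
        x + + ϱ₁ * (x - N) + 0ℤ  ≡⟨ ℤₚ.+-identityʳ _ ⟩
        x + + ϱ₁ * (x - N)       <⟨ ℤₚ.+-monoʳ-< x (ℤₚ.*-monoˡ-<-pos (+ ϱ₁) x-N<0) ⟩
        x + + ϱ₁ * 0ℤ            ≡⟨ cong (_+_ x) (ℤₚ.*-zeroʳ (+ ϱ₁)) ⟩
        x + 0ℤ                   ≡⟨ ℤₚ.+-identityʳ x ⟩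
        x                        ∎
        where
        open ℤₚ.≤-Reasoning
        x-N<0 : x - N < 0ℤ
        x-N<0 = subst (x - N <_) (ℤₚ.+-inverseʳ N) (ℤₚ.+-monoˡ-< (- N) x<N)

      step-maxs-> : ∀ x → - P < x → x < step x maxs
      step-maxs-> x -P<x = begin-strict
        x                                    ≡⟨ ℤₚ.+-identityʳ x ⟨
        x + 0ℤ                               ≡⟨ cong (_+_ x) (ℤₚ.*-zeroʳ (+ ϱ₁)) ⟨
        x + + ϱ₁ * 0ℤ                        <⟨ ℤₚ.+-monoʳ-< x (ℤₚ.*-monoˡ-<-pos (+ ϱ₁) 0<x+P) ⟩
        x + + ϱ₁ * (x + P)                   ≡⟨ regroup x (+ ϱ₁) P N ⟩
        x + + ϱ₁ * (x - N) + + ϱ₁ * (P + N)  ≤⟨ step-lower x maxs (subst (λ K → + ϱ₁ * K ≤ digitWeight maxs) (norm≡norm++norm- t)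
                                                  (weight-≥ t (map⁺ (All-replicate r (ℤₚ.≤-reflexive (cong +_ (sym (Finₚ.toℕ-fromℕ ϱ₁)))))))) ⟩
        step x maxs                          ∎
        where
        open ℤₚ.≤-Reasoning
        0<x+P : 0ℤ < x + P
        0<x+P = subst (_< x + P) (ℤₚ.+-inverseˡ P) (ℤₚ.+-monoˡ-< P -P<x)
        regroup : ∀ x g P N → x + g * (x + P) ≡ x + g * (x - N) + g * (P + N)
        regroup = solve-∀

      module Reachability (a : Vec ℤ r) (wa≡1 : weight t a ≡ 1ℤ) {m n : ℤ} (m<-P : m < - P) (N<n : N < n)
                          {p : ℤ} (-P<p : - P < p) (p<N : p < N) where
        open Clamped m<-P N<n

        Reaches : ℤ → Set
        Reaches q = Σ (List (Letter ϱ r)) λ u → δ̂ ϱ t m n (int p) u ≡ int q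

        1≤N-p : 1ℤ ≤ N - p
        1≤N-p = ≤-by-certificate (N - (1ℤ + p)) (certificate N p) (ℤₚ.i≤j⇒0≤j-i (ℤₚ.i<j⇒suc[i]≤j p<N))
          where
          certificate : ∀ N p → N - p - 1ℤ ≡ N - (1ℤ + p)
          certificate = solve-∀

        N-p<norm : N - p < + norm t
        N-p<norm = subst (N - p <_) (sym (norm≡norm++norm- t)) (ℤₚ.suc[i]≤j⇒i<j
          (≤-by-certificate (p - (1ℤ + - P)) (certificate P N p) (ℤₚ.i≤j⇒0≤j-i (ℤₚ.i<j⇒suc[i]≤j -P<p))))
          where
          certificate : ∀ P N p → P + N - (1ℤ + (N - p)) ≡ p - (1ℤ + - P)
          certificate = solve-∀

        reach-inside : ∀ q → Inside q → Reaches q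
        reach-inside q inside = List.map (toLetter t) (digitsWord B v) , (begin
          δ̂ ϱ t m n (int p) (List.map (toLetter t) (digitsWord B v))  ≡⟨ δ̂-run p (digitsWord B v) (subst Inside (sym run≡q) inside) ⟩
          int (run p (digitsWord B v))                                  ≡⟨ cong int run≡q ⟩
          int q                                                         ∎)
          where
          open ≡-Reasoning
          C : ℤ
          C = + norm t * + norm t * + norm a + + norm t + + ∣ q - N ∣
          B : ℕ
          B = ∣ C ∣
          C≤ϱ^B : C ≤ + (ϱ ^ B)
          C≤ϱ^B = ℤₚ.≤-trans (i≤+∣i∣ C) (+≤+ (ℕₚ.<⇒≤ (n<m^n (s≤s (ℕ.>-nonZero⁻¹ ϱ₁)) B)))
          box = box-representation t a wa≡1 (ϱ ^ B) 1≤N-p N-p<norm C≤ϱ^B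
          v = proj₁ box
          run≡q : run p (digitsWord B v) ≡ q
          run≡q = begin
            run p (digitsWord B v)                                     ≡⟨ run-digitsWord B v (proj₁ (proj₂ box)) p ⟩
            + (ϱ ^ B) * (p - N) + weight t (map +_ v) + N              ≡⟨ cong (λ w → + (ϱ ^ B) * (p - N) + w + N) (proj₂ (proj₂ box)) ⟩
            + (ϱ ^ B) * (p - N) + (+ (ϱ ^ B) * (N - p) + (q - N)) + N  ≡⟨ cancel (+ (ϱ ^ B)) p N q ⟩
            q                                                          ∎
            where
            cancel : ∀ M p N q → M * (p - N) + (M * (N - p) + (q - N)) + N ≡ q
            cancel = solve-∀

        reach-via : ∀ {q} x d → Inside x → clamp m n (step x d) ≡ q → Reaches q
        reach-via {q} x d inside clamp≡q = u ∷ʳ toLetter t d , (begin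
          δ̂ ϱ t m n (int p) (u ∷ʳ toLetter t d)           ≡⟨ δ̂-∷ʳ ϱ t m n (int p) u (toLetter t d) ⟩
          δ ϱ t m n (δ̂ ϱ t m n (int p) u) (toLetter t d)  ≡⟨ cong (λ s → δ ϱ t m n s (toLetter t d)) (proj₂ (reach-inside x inside)) ⟩
          int (clamp m n (step x d))                      ≡⟨ cong int clamp≡q ⟩
          int q                                           ∎)
          where
          open ≡-Reasoning
          u : List (Letter ϱ r)
          u = proj₁ (reach-inside x inside)

        reach-lower : Reaches m
        reach-lower = reach-via (ℤ.suc m) zeros (m<1+m , ℤₚ.<-trans 1+m<N N<n) (clamp-below {n = n} step≤m)
          where
          m<1+m : m < ℤ.suc m
          m<1+m = ℤₚ.suc[i]≤j⇒i<j ℤₚ.≤-refl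
          1+m<N : ℤ.suc m < N
          1+m<N = ℤₚ.≤-<-trans (ℤₚ.i<j⇒suc[i]≤j m<-P) (ℤₚ.<-trans -P<p p<N)
          step≤m : step (ℤ.suc m) zeros ≤ m
          step≤m = subst (step (ℤ.suc m) zeros ≤_) (ℤₚ.pred-suc m) (ℤₚ.i<j⇒i≤pred[j] (step-zeros-< (ℤ.suc m) 1+m<N))

        reach-upper : Reaches n
        reach-upper = reach-via (ℤ.pred n) maxs (m<n-1 , n-1<n) (clamp-above (ℤₚ.<-≤-trans (ℤₚ.<-trans m<n-1 n-1<n) n≤step) n≤step)
          where
          n-1<n : ℤ.pred n < n
          n-1<n = ℤₚ.i≤pred[j]⇒i<j ℤₚ.≤-refl
          -P<n-1 : - P < ℤ.pred n
          -P<n-1 = ℤₚ.<-≤-trans (ℤₚ.<-trans -P<p p<N) (ℤₚ.i<j⇒i≤pred[j] N<n)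
          m<n-1 : m < ℤ.pred n
          m<n-1 = ℤₚ.<-trans m<-P -P<n-1
          n≤step : n ≤ step (ℤ.pred n) maxs
          n≤step = subst (_≤ step (ℤ.pred n) maxs) (ℤₚ.suc-pred n) (ℤₚ.i<j⇒suc[i]≤j (step-maxs-> (ℤ.pred n) -P<n-1))

        reach : ∀ q → m ≤ q → q ≤ n → Reaches q
        reach q m≤q q≤n with m ℤ.≟ q | q ℤ.≟ n
        ... | yes refl | _        = reach-lower
        ... | no _     | yes refl = reach-upper
        ... | no m≢q   | no q≢n   = reach-inside q (ℤₚ.≤∧≢⇒< m≤q m≢q , ℤₚ.≤∧≢⇒< q≤n q≢n)

lemma3p10 : (ϱ : ℕ) → 2 Data.Nat.≤ ϱ → (r : ℕ) → (t : Term r) → All (_≢ 0ℤ) t → gcdAbs t ≡ 1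
    → (c : ℤ) → (R : Rel) → (m n : ℤ)
    → Small t c m → (∀ q → Small t c q → q ≤ m)
    → Large t c n → (∀ q → Large t c q → n ≤ q)
    → (p : ℤ) → - norm+ t < p → p < norm- t
    → (q : ℤ) → m ≤ q → q ≤ n
    → Σ (List (Letter ϱ r)) (λ u → δ̂ ϱ t m n (int p) u ≡ int q)
lemma3p10 (suc (suc ϱ₀)) (s≤s (s≤s z≤n)) r t _ gcd≡1 c _ m n m-small _ n-large _ p -P<p p<N =
  Automaton.Reachability.reach (suc ϱ₀) t a wa≡1 m<-P N<n -P<p p<N
  where
  a : Vec ℤ r
  a = proj₁ (weight-Bézout t)
  wa≡1 : weight t a ≡ 1ℤ
  wa≡1 = trans (proj₂ (weight-Bézout t)) (cong +_ gcd≡1)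
  m<-P : m < - norm+ t
  m<-P = ℤₚ.<-≤-trans m-small (ℤₚ.i⊓j≤j c (- norm+ t))
  N<n : norm- t < n
  N<n = ℤₚ.≤-<-trans (ℤₚ.i≤j⊔i c (norm- t)) n-large
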